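{- Let $\beta>1$ be the root of $x^2-ax-1$ with $a$ a positive integer, and $\alpha=-\beta^{ -1}$. Let $q\in\mathbb{Q}\cap(-1,1)$ and run the following algorithm. Start with $s^{(0)}_0=q$ and $s^{(0)}_j=0$ for $j\ge1$. For $i=0,1,2,\dots$, obtain $s^{(i+1)}$ from $s^{(i)}$ by setting $\delta=\lceil s^{(i)}_i\rceil-s^{(i)}_i$ and $s^{(i+1)}_i=\lceil s^{(i)}_i\rceil$, $s^{(i+1)}_{i+1}=s^{(i)}_{i+1}+a\delta$, $s^{(i+1)}_{i+2}=s^{(i)}_{i+2}-\delta$, and $s^{(i+1)}_j=s^{(i)}_j$ for all other $j$. Let the output word be $s=(s_i)_{i\ge0}$ with $s_i=s^{(i+1)}_i\in\{0,1,\dots,a\}$. Then the number of consecutive letters $a$ in the output word is bounded: there exists $C$ (depending on $q$) such that $s$ contains no block of more than $C$ consecutive digits equal to $a$. -}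

module Defs where

open import Data.Nat as ℕ using (ℕ; zero; suc; _≟_)
open import Data.Integer as ℤ using (ℤ; +_)
open import Data.Rational using (ℚ; _+_; _-_; _*_; _/_; 0ℚ; ceiling)
open import Relation.Nullary using (yes; no)

ℕ→ℚ : ℕ → ℚ
ℕ→ℚ n = (+ n) / 1

ℤ→ℚ : ℤ → ℚ
ℤ→ℚ z = z / 1

initSeq : ℚ → ℕ → ℚ
initSeq q zero    = q
initSeq q (suc j) = 0ℚ

step : ℕ → ℕ → (ℕ → ℚ) → (ℕ → ℚ)
step a i s j with j ≟ i
... | yes _ = ℤ→ℚ (ceiling (s i))
... | no _ with j ≟ suc i
...   | yes _ = s j + ℕ→ℚ a * (ℤ→ℚ (ceiling (s i)) - s i)
...   | no _ with j ≟ suc (suc i)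
...     | yes _ = s j - (ℤ→ℚ (ceiling (s i)) - s i)
...     | no _  = s j

seqAt : ℕ → ℚ → ℕ → (ℕ → ℚ)
seqAt a q zero    = initSeq q
seqAt a q (suc i) = step a i (seqAt a q i)

output : ℕ → ℚ → ℕ → ℚ
output a q i = seqAt a q (suc i) i

{-# OPTIONS --safe #-}
-- Write x i for the entry s⁽ⁱ⁾ᵢ that stage i rounds up, and δ p = ⌈p⌉ − p ∈ [0, 1).
-- Stage i only changes positions i, i+1 and i+2, so x 0 = q, x 1 = a δ(x 0) and
-- x (i+2) = a δ(x (i+1)) − δ(x i). Hence every x i lies in D⁻¹ℤ, where D is the
-- denominator of q, and Dδ i = D δ(x i) is an integer in [0, D). If the output digit
-- ⌈x (j+2)⌉ equals a, then δ(x (j+2)) = δ(x j) + a (1 − δ(x (j+1))), so Dδ (j+2) > Dδ j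
-- because a ≥ 1 and δ(x (j+1)) < 1. Along a block of 2D+1 letters a, Dδ would grow by D
-- over every second index and leave [0, D).
module Submission where

open import Data.Integer.Base as ℤ using (ℤ; +_; 0ℤ; 1ℤ)
import Data.Integer.Properties as ℤ
import Data.Integer.DivMod as ℤ
open import Data.Nat.Base as ℕ using (ℕ; zero; suc)
import Data.Nat.Properties as ℕ
import Data.Nat.Coprimality as Coprimality
open import Data.Nat.Tactic.RingSolver using (solve-∀)
open import Data.Rational.Base using (ℚ; ↧ₙ_)
open import Data.Rational.Unnormalised.Base as ℚᵘ using (mkℚᵘ)
import Data.Rational.Unnormalised.Properties as ℚᵘ
open import Data.Product using (∃; _×_; _,_; proj₁)
open import Relation.Binary.PropositionalEquality
open import Relation.Nullary using (¬_)
open import Defs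

module IntegerEmbedding where
  open import Data.Rational.Base
  open import Data.Rational.Properties

  ℤ→ℚ≡mkℚ : ∀ z → ℤ→ℚ z ≡ mkℚ z 0 (Coprimality.sym (Coprimality.1-coprimeTo ℤ.∣ z ∣))
  ℤ→ℚ≡mkℚ z = ↥p/↧p≡p (mkℚ z 0 _)

  ℤ→ℚ-homo-+ : ∀ m n → ℤ→ℚ (m ℤ.+ n) ≡ ℤ→ℚ m + ℤ→ℚ n
  ℤ→ℚ-homo-+ m n = begin
    ℤ→ℚ (m ℤ.+ n)                  ≡⟨ cong ℤ→ℚ (cong₂ ℤ._+_ (ℤ.*-identityʳ m) (ℤ.*-identityʳ n)) ⟨
    ℤ→ℚ (m ℤ.* + 1 ℤ.+ n ℤ.* + 1)  ≡⟨ cong₂ _+_ (ℤ→ℚ≡mkℚ m) (ℤ→ℚ≡mkℚ n) ⟨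
    ℤ→ℚ m + ℤ→ℚ n                  ∎
    where open ≡-Reasoning

  ℤ→ℚ-homo-* : ∀ m n → ℤ→ℚ (m ℤ.* n) ≡ ℤ→ℚ m * ℤ→ℚ n
  ℤ→ℚ-homo-* m n = sym (cong₂ _*_ (ℤ→ℚ≡mkℚ m) (ℤ→ℚ≡mkℚ n))

  ℤ→ℚ-homo-neg : ∀ z → ℤ→ℚ (ℤ.- z) ≡ - ℤ→ℚ z
  ℤ→ℚ-homo-neg z = begin
    ℤ→ℚ (ℤ.- z)      ≡⟨ ℤ→ℚ≡mkℚ (ℤ.- z) ⟩
    mkℚ (ℤ.- z) 0 _  ≡⟨ neg-mkℚ z ⟩
    - mkℚ z 0 _      ≡⟨ cong -_ (ℤ→ℚ≡mkℚ z) ⟨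
    - ℤ→ℚ z          ∎
    where
    open ≡-Reasoning
    neg-mkℚ : ∀ z .{c : Coprimality.Coprime ℤ.∣ ℤ.- z ∣ 1} .{c′ : Coprimality.Coprime ℤ.∣ z ∣ 1} →
              mkℚ (ℤ.- z) 0 c ≡ - mkℚ z 0 c′
    neg-mkℚ (+ zero)   = refl
    neg-mkℚ (+ suc n)  = refl
    neg-mkℚ ℤ.-[1+ n ] = refl

  ℤ→ℚ-homo-- : ∀ m n → ℤ→ℚ (m ℤ.- n) ≡ ℤ→ℚ m - ℤ→ℚ n
  ℤ→ℚ-homo-- m n = trans (ℤ→ℚ-homo-+ m (ℤ.- n)) (cong (_+_ (ℤ→ℚ m)) (ℤ→ℚ-homo-neg n))

  ℤ→ℚ-injective : ∀ {m n} → ℤ→ℚ m ≡ ℤ→ℚ n → m ≡ n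
  ℤ→ℚ-injective {m} {n} eq = cong ↥_ (trans (sym (ℤ→ℚ≡mkℚ m)) (trans eq (ℤ→ℚ≡mkℚ n)))

  ℤ→ℚ-cancel-≤ : ∀ {m n} → ℤ→ℚ m ≤ ℤ→ℚ n → m ℤ.≤ n
  ℤ→ℚ-cancel-≤ {m} {n} m≤n with *≤* m*1≤n*1 ← subst₂ _≤_ (ℤ→ℚ≡mkℚ m) (ℤ→ℚ≡mkℚ n) m≤n =
    subst₂ ℤ._≤_ (ℤ.*-identityʳ m) (ℤ.*-identityʳ n) m*1≤n*1

  ℤ→ℚ-cancel-< : ∀ {m n} → ℤ→ℚ m < ℤ→ℚ n → m ℤ.< n
  ℤ→ℚ-cancel-< {m} {n} m<n with *<* m*1<n*1 ← subst₂ _<_ (ℤ→ℚ≡mkℚ m) (ℤ→ℚ≡mkℚ n) m<n =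
    subst₂ ℤ._<_ (ℤ.*-identityʳ m) (ℤ.*-identityʳ n) m*1<n*1

  z↧p≤↥p⇒z≤p : ∀ {z p} → z ℤ.* ↧ p ℤ.≤ ↥ p → ℤ→ℚ z ≤ p
  z↧p≤↥p⇒z≤p {z} {p} z↧p≤↥p = subst (_≤ p) (sym (ℤ→ℚ≡mkℚ z))
    (*≤* (subst (z ℤ.* ↧ p ℤ.≤_) (sym (ℤ.*-identityʳ (↥ p))) z↧p≤↥p))

  ↥p<z↧p⇒p<z : ∀ {z p} → ↥ p ℤ.< z ℤ.* ↧ p → p < ℤ→ℚ z
  ↥p<z↧p⇒p<z {z} {p} ↥p<z↧p = subst (p <_) (sym (ℤ→ℚ≡mkℚ z))
    (*<* (subst (ℤ._< z ℤ.* ↧ p) (sym (ℤ.*-identityʳ (↥ p))) ↥p<z↧p))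

  ℤ→ℚ-pos : ∀ n → Positive (ℤ→ℚ (+ suc n))
  ℤ→ℚ-pos n = subst Positive (sym (ℤ→ℚ≡mkℚ (+ suc n))) _

  p*↧p≡↥p : ∀ p → p * ℤ→ℚ (↧ p) ≡ ℤ→ℚ (↥ p)
  p*↧p≡↥p p@(mkℚ n d-1 _) = toℚᵘ-injective (begin
    toℚᵘ (p * ℤ→ℚ (↧ p))          ≈⟨ toℚᵘ-homo-* p (ℤ→ℚ (↧ p)) ⟩
    toℚᵘ p ℚᵘ.* toℚᵘ (ℤ→ℚ (↧ p))  ≡⟨ cong (toℚᵘ p ℚᵘ.*_) (toℚᵘ-ℤ→ℚ (↧ p)) ⟩
    mkℚᵘ n d-1 ℚᵘ.* mkℚᵘ (↧ p) 0  ≈⟨ ℚᵘ.*≡* n*D≡n*D*1 ⟨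
    mkℚᵘ n 0                      ≡⟨ toℚᵘ-ℤ→ℚ n ⟨
    toℚᵘ (ℤ→ℚ n)                  ∎)
    where
    open ℚᵘ.≃-Reasoning
    toℚᵘ-ℤ→ℚ : ∀ z → toℚᵘ (ℤ→ℚ z) ≡ mkℚᵘ z 0
    toℚᵘ-ℤ→ℚ z = cong toℚᵘ (ℤ→ℚ≡mkℚ z)
    n*D≡n*D*1 : n ℤ.* + (suc d-1 ℕ.* 1) ≡ n ℤ.* ↧ p ℤ.* + 1
    n*D≡n*D*1 = trans (cong (λ k → n ℤ.* + k) (ℕ.*-identityʳ (suc d-1))) (sym (ℤ.*-identityʳ _))

open IntegerEmbedding

module Rounding where
  open import Data.Rational.Base
  open import Data.Rational.Properties

  ⌊p⌋≤p : ∀ p → ℤ→ℚ ⌊ p ⌋ ≤ p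
  ⌊p⌋≤p p@(mkℚ _ _ _) = z↧p≤↥p⇒z≤p {⌊ p ⌋} {p} (ℤ.[n/d]*d≤n (↥ p) (↧ p))

  p<1+⌊p⌋ : ∀ p → p < 1ℚ + ℤ→ℚ ⌊ p ⌋
  p<1+⌊p⌋ p@(mkℚ _ _ _) = subst (p <_) (ℤ→ℚ-homo-+ 1ℤ ⌊ p ⌋)
    (↥p<z↧p⇒p<z {ℤ.suc ⌊ p ⌋} {p} (subst (λ f → ↥ p ℤ.< ℤ.suc f ℤ.* ↧ p)
      (sym (ℤ.div-pos-is-/ℕ (↥ p) (↧ₙ p))) (ℤ.n<s[n/ℕd]*d (↥ p) (↧ₙ p))))

  0≤p-⌊p⌋ : ∀ p → 0ℚ ≤ p - ℤ→ℚ ⌊ p ⌋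
  0≤p-⌊p⌋ p = subst (_≤ p - ℤ→ℚ ⌊ p ⌋) (+-inverseʳ (ℤ→ℚ ⌊ p ⌋)) (+-monoˡ-≤ (- ℤ→ℚ ⌊ p ⌋) (⌊p⌋≤p p))

  p-⌊p⌋<1 : ∀ p → p - ℤ→ℚ ⌊ p ⌋ < 1ℚ
  p-⌊p⌋<1 p = subst (p - f <_) 1+f-f≡1 (+-monoˡ-< (- f) (p<1+⌊p⌋ p))
    where
    f = ℤ→ℚ ⌊ p ⌋
    1+f-f≡1 : 1ℚ + f - f ≡ 1ℚ
    1+f-f≡1 = trans (+-assoc 1ℚ f (- f)) (trans (cong (_+_ 1ℚ) (+-inverseʳ f)) (+-identityʳ 1ℚ))

  δ : ℚ → ℚ
  δ p = ℤ→ℚ ⌈ p ⌉ - p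

  δ≡-p-⌊-p⌋ : ∀ p → δ p ≡ - p - ℤ→ℚ ⌊ - p ⌋
  δ≡-p-⌊-p⌋ p@(mkℚ _ _ _) =
    trans (cong (_- p) (ℤ→ℚ-homo-neg ⌊ - p ⌋)) (+-comm (- ℤ→ℚ ⌊ - p ⌋) (- p))

  0≤δ : ∀ p → 0ℚ ≤ δ p
  0≤δ p = subst (0ℚ ≤_) (sym (δ≡-p-⌊-p⌋ p)) (0≤p-⌊p⌋ (- p))

  δ<1 : ∀ p → δ p < 1ℚ
  δ<1 p = subst (_< 1ℚ) (sym (δ≡-p-⌊-p⌋ p)) (p-⌊p⌋<1 (- p))

open Rounding

module Grid where
  open import Data.Rational.Base
  open import Data.Rational.Properties
  open ≡-Reasoning

  infix 4 _∈_⁻¹ℤ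
  record _∈_⁻¹ℤ (p : ℚ) (d : ℤ) : Set where
    constructor _,_
    field
      scaled     : ℤ
      p*d≡scaled : p * ℤ→ℚ d ≡ ℤ→ℚ scaled

  p∈↧p⁻¹ℤ : ∀ p → p ∈ ↧ p ⁻¹ℤ
  p∈↧p⁻¹ℤ p = ↥ p , p*↧p≡↥p p

  ℤ→ℚ-∈ : ∀ {d} z → ℤ→ℚ z ∈ d ⁻¹ℤ
  ℤ→ℚ-∈ {d} z = z ℤ.* d , sym (ℤ→ℚ-homo-* z d)

  +-∈ : ∀ {d p r} → p ∈ d ⁻¹ℤ → r ∈ d ⁻¹ℤ → p + r ∈ d ⁻¹ℤ
  +-∈ {d} {p} {r} (m , pd≡m) (n , rd≡n) = m ℤ.+ n , (begin
    (p + r) * ℤ→ℚ d        ≡⟨ *-distribʳ-+ (ℤ→ℚ d) p r ⟩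
    p * ℤ→ℚ d + r * ℤ→ℚ d  ≡⟨ cong₂ _+_ pd≡m rd≡n ⟩
    ℤ→ℚ m + ℤ→ℚ n          ≡⟨ ℤ→ℚ-homo-+ m n ⟨
    ℤ→ℚ (m ℤ.+ n)          ∎)

  neg-∈ : ∀ {d p} → p ∈ d ⁻¹ℤ → - p ∈ d ⁻¹ℤ
  neg-∈ {d} {p} (m , pd≡m) = ℤ.- m , (begin
    - p * ℤ→ℚ d    ≡⟨ neg-distribˡ-* p (ℤ→ℚ d) ⟨
    - (p * ℤ→ℚ d)  ≡⟨ cong -_ pd≡m ⟩
    - ℤ→ℚ m        ≡⟨ ℤ→ℚ-homo-neg m ⟨
    ℤ→ℚ (ℤ.- m)    ∎)

  -‿∈ : ∀ {d p r} → p ∈ d ⁻¹ℤ → r ∈ d ⁻¹ℤ → p - r ∈ d ⁻¹ℤ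
  -‿∈ p∈ r∈ = +-∈ p∈ (neg-∈ r∈)

  ℤ*-∈ : ∀ {d p} k → p ∈ d ⁻¹ℤ → ℤ→ℚ k * p ∈ d ⁻¹ℤ
  ℤ*-∈ {d} {p} k (m , pd≡m) = k ℤ.* m , (begin
    ℤ→ℚ k * p * ℤ→ℚ d    ≡⟨ *-assoc (ℤ→ℚ k) p (ℤ→ℚ d) ⟩
    ℤ→ℚ k * (p * ℤ→ℚ d)  ≡⟨ cong (ℤ→ℚ k *_) pd≡m ⟩
    ℤ→ℚ k * ℤ→ℚ m        ≡⟨ ℤ→ℚ-homo-* k m ⟨
    ℤ→ℚ (k ℤ.* m)        ∎)

  δ-∈ : ∀ {d p} → p ∈ d ⁻¹ℤ → δ p ∈ d ⁻¹ℤ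
  δ-∈ {p = p} = -‿∈ (ℤ→ℚ-∈ ⌈ p ⌉)

open Grid

module Runs where
  open import Data.Integer.Base using (_≤_; _<_; _+_; _*_; _-_)

  i<j⇒0<j-i : ∀ {i j} → i < j → 0ℤ < j - i
  i<j⇒0<j-i {i} {j} i<j = subst (_< j - i) (ℤ.+-inverseʳ i) (ℤ.+-monoˡ-< (ℤ.- i) i<j)

  i<i+m*n : ∀ i {m n} → 0ℤ < m → 0ℤ < n → i < i + m * n
  i<i+m*n i {m} {n} 0<m 0<n =
    subst (_< i + m * n) (trans (cong (_+_ i) (ℤ.*-zeroʳ m)) (ℤ.+-identityʳ i))
    (ℤ.+-monoʳ-< i (ℤ.*-monoˡ-<-pos m {{ℤ.positive 0<m}} 0<n))

  +n≤g[n] : ∀ (g : ℕ → ℤ) n → 0ℤ ≤ g 0 → (∀ m → m ℕ.< n → g m < g (suc m)) → + n ≤ g n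
  +n≤g[n] g zero    0≤g[0] _   = 0≤g[0]
  +n≤g[n] g (suc n) 0≤g[0] inc = ℤ.i<j⇒suc[i]≤j
    (ℤ.≤-<-trans (+n≤g[n] g n 0≤g[0] (λ m m<n → inc m (ℕ.m<n⇒m<1+n m<n))) (inc n ℕ.≤-refl))

  i+2[1+m]≡2+[i+2m] : ∀ i m → i ℕ.+ 2 ℕ.* suc m ≡ suc (suc (i ℕ.+ 2 ℕ.* m))
  i+2[1+m]≡2+[i+2m] = solve-∀

  no-long-run : ∀ (w : ℕ → ℤ) (D : ℕ) (P : ℕ → Set) →
                (∀ i → 0ℤ ≤ w i) → (∀ i → w i < + D) →
                (∀ j → P (suc (suc j)) → w j < w (suc (suc j))) →
                ∀ i → ¬ (∀ k → k ℕ.≤ 2 ℕ.* D → P (i ℕ.+ k))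
  no-long-run w D P 0≤w w<D inc i run =
    ℤ.≤⇒≯ (+n≤g[n] (λ m → w (i ℕ.+ 2 ℕ.* m)) D (0≤w _) every-second) (w<D (i ℕ.+ 2 ℕ.* D))
    where
    every-second : ∀ m → m ℕ.< D → w (i ℕ.+ 2 ℕ.* m) < w (i ℕ.+ 2 ℕ.* suc m)
    every-second m m<D rewrite i+2[1+m]≡2+[i+2m] i m =
      inc (i ℕ.+ 2 ℕ.* m) (subst P (i+2[1+m]≡2+[i+2m] i m) (run (2 ℕ.* suc m) (ℕ.*-monoʳ-≤ 2 m<D)))

open Runs

module Step (a : ℕ) where
  open import Data.Rational.Base
  open import Relation.Nullary.Decidable using (dec-no)

  step-here : ∀ i s → step a i s i ≡ ℤ→ℚ ⌈ s i ⌉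
  step-here i s rewrite ℕ.≟-diag (refl {x = i}) = refl

  step-next : ∀ i s → step a i s (suc i) ≡ s (suc i) + ℕ→ℚ a * δ (s i)
  step-next i s rewrite dec-no (suc i ℕ.≟ i) ℕ.1+n≢n | ℕ.≟-diag (refl {x = suc i}) = refl

  step-after-next : ∀ i s → step a i s (suc (suc i)) ≡ s (suc (suc i)) - δ (s i)
  step-after-next i s
    rewrite dec-no (suc (suc i) ℕ.≟ i) (ℕ.>⇒≢ (ℕ.m<n⇒m<1+n (ℕ.n<1+n i)))
          | dec-no (suc (suc i) ℕ.≟ suc i) ℕ.1+n≢n
          | ℕ.≟-diag (refl {x = suc (suc i)}) = refl

  step-beyond : ∀ i s {j} → suc (suc i) ℕ.< j → step a i s j ≡ s j
  step-beyond i s {j} i+2<j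
    rewrite dec-no (j ℕ.≟ i) (ℕ.>⇒≢ (ℕ.m+n≤o⇒n≤o 2 i+2<j))
          | dec-no (j ℕ.≟ suc i) (ℕ.>⇒≢ (ℕ.m+n≤o⇒n≤o 1 i+2<j))
          | dec-no (j ℕ.≟ suc (suc i)) (ℕ.>⇒≢ i+2<j) = refl

module Algorithm (a : ℕ) (q : ℚ) where
  open import Data.Rational.Base
  open import Data.Rational.Properties
  open import Data.Rational.Solver using (module +-*-Solver)
  open Step a

  s : ℕ → ℕ → ℚ
  s = seqAt a q

  x : ℕ → ℚ
  x i = s i i

  s-beyond : ∀ i {j} → suc i ℕ.< j → s i j ≡ 0ℚ
  s-beyond zero    {suc zero}    (ℕ.s≤s ())
  s-beyond zero    {suc (suc j)} _     = refl
  s-beyond (suc i) {j}           i+2<j =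
    trans (step-beyond i (s i) i+2<j) (s-beyond i (ℕ.<-trans (ℕ.n<1+n (suc i)) i+2<j))

  output≡⌈x⌉ : ∀ i → output a q i ≡ ℤ→ℚ ⌈ x i ⌉
  output≡⌈x⌉ i = step-here i (s i)

  x-suc : ∀ i → x (suc i) ≡ s i (suc i) + ℕ→ℚ a * δ (x i)
  x-suc i = step-next i (s i)

  x-suc-suc : ∀ i → x (suc (suc i)) ≡ (0ℚ - δ (x i)) + ℕ→ℚ a * δ (x (suc i))
  x-suc-suc i = trans (x-suc (suc i)) (cong (_+ ℕ→ℚ a * δ (x (suc i)))
    (trans (step-after-next i (s i)) (cong (_- δ (x i)) (s-beyond i ℕ.≤-refl))))

  D : ℤ
  D = ↧ q

  x-∈ : ∀ i → x i ∈ D ⁻¹ℤ × x (suc i) ∈ D ⁻¹ℤ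
  x-∈ zero = p∈↧p⁻¹ℤ q ,
    subst (_∈ D ⁻¹ℤ) (sym (x-suc 0)) (+-∈ (ℤ→ℚ-∈ 0ℤ) (ℤ*-∈ (+ a) (δ-∈ (p∈↧p⁻¹ℤ q))))
  x-∈ (suc i) with x∈ , x′∈ ← x-∈ i = x′∈ ,
    subst (_∈ D ⁻¹ℤ) (sym (x-suc-suc i)) (+-∈ (-‿∈ (ℤ→ℚ-∈ 0ℤ) (δ-∈ x∈)) (ℤ*-∈ (+ a) (δ-∈ x′∈)))

  Dδ : ℕ → ℤ
  Dδ i = _∈_⁻¹ℤ.scaled (δ-∈ (proj₁ (x-∈ i)))

  δ*D≡Dδ : ∀ i → δ (x i) * ℤ→ℚ D ≡ ℤ→ℚ (Dδ i)
  δ*D≡Dδ i = _∈_⁻¹ℤ.p*d≡scaled (δ-∈ (proj₁ (x-∈ i)))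

  instance
    D-pos : Positive (ℤ→ℚ D)
    D-pos = ℤ→ℚ-pos (ℚ.denominator-1 q)

  0≤Dδ : ∀ i → 0ℤ ℤ.≤ Dδ i
  0≤Dδ i = ℤ→ℚ-cancel-≤ (subst₂ _≤_ (*-zeroˡ (ℤ→ℚ D)) (δ*D≡Dδ i)
    (*-monoʳ-≤-nonNeg (ℤ→ℚ D) {{pos⇒nonNeg (ℤ→ℚ D)}} (0≤δ (x i))))

  Dδ<D : ∀ i → Dδ i ℤ.< D
  Dδ<D i = ℤ→ℚ-cancel-< (subst₂ _<_ (δ*D≡Dδ i) (*-identityˡ (ℤ→ℚ D))
    (*-monoˡ-<-pos (ℤ→ℚ D) (δ<1 (x i))))

  δ-rec : ∀ j → output a q (suc (suc j)) ≡ ℕ→ℚ a →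
          δ (x (suc (suc j))) ≡ δ (x j) + ℕ→ℚ a * (1ℚ - δ (x (suc j)))
  δ-rec j out≡a = begin
    ℤ→ℚ ⌈ x (suc (suc j)) ⌉ - x (suc (suc j))
      ≡⟨ cong (_- x (suc (suc j))) (trans (sym (output≡⌈x⌉ (suc (suc j)))) out≡a) ⟩
    ℕ→ℚ a - x (suc (suc j))
      ≡⟨ cong (_-_ (ℕ→ℚ a)) (x-suc-suc j) ⟩
    ℕ→ℚ a - ((0ℚ - δ (x j)) + ℕ→ℚ a * δ (x (suc j)))
      ≡⟨ rearrange (ℕ→ℚ a) (δ (x j)) (δ (x (suc j))) ⟩
    δ (x j) + ℕ→ℚ a * (1ℚ - δ (x (suc j)))
      ∎
    where
    open ≡-Reasoning
    open +-*-Solver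
    rearrange : ∀ A d d′ → A - ((0ℚ - d) + A * d′) ≡ d + A * (1ℚ - d′)
    rearrange = solve 3
      (λ A d d′ → A :- ((con 0ℚ :- d) :+ A :* d′) := d :+ A :* (con 1ℚ :- d′)) refl

  Dδ-rec : ∀ j → output a q (suc (suc j)) ≡ ℕ→ℚ a →
           Dδ (suc (suc j)) ≡ Dδ j ℤ.+ + a ℤ.* (D ℤ.- Dδ (suc j))
  Dδ-rec j out≡a = ℤ→ℚ-injective (begin
    ℤ→ℚ (Dδ (suc (suc j)))
      ≡⟨ δ*D≡Dδ (suc (suc j)) ⟨
    δ (x (suc (suc j))) * ℤ→ℚ D
      ≡⟨ cong (_* ℤ→ℚ D) (δ-rec j out≡a) ⟩
    (δ (x j) + ℕ→ℚ a * (1ℚ - δ (x (suc j)))) * ℤ→ℚ D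
      ≡⟨ distribute (δ (x j)) (ℕ→ℚ a) (δ (x (suc j))) (ℤ→ℚ D) ⟩
    δ (x j) * ℤ→ℚ D + ℕ→ℚ a * (ℤ→ℚ D - δ (x (suc j)) * ℤ→ℚ D)
      ≡⟨ cong₂ (λ u v → u + ℕ→ℚ a * (ℤ→ℚ D - v)) (δ*D≡Dδ j) (δ*D≡Dδ (suc j)) ⟩
    ℤ→ℚ (Dδ j) + ℤ→ℚ (+ a) * (ℤ→ℚ D - ℤ→ℚ (Dδ (suc j)))
      ≡⟨ cong (λ u → ℤ→ℚ (Dδ j) + ℤ→ℚ (+ a) * u) (ℤ→ℚ-homo-- D (Dδ (suc j))) ⟨
    ℤ→ℚ (Dδ j) + ℤ→ℚ (+ a) * ℤ→ℚ (D ℤ.- Dδ (suc j))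
      ≡⟨ cong (_+_ (ℤ→ℚ (Dδ j))) (ℤ→ℚ-homo-* (+ a) (D ℤ.- Dδ (suc j))) ⟨
    ℤ→ℚ (Dδ j) + ℤ→ℚ (+ a ℤ.* (D ℤ.- Dδ (suc j)))
      ≡⟨ ℤ→ℚ-homo-+ (Dδ j) (+ a ℤ.* (D ℤ.- Dδ (suc j))) ⟨
    ℤ→ℚ (Dδ j ℤ.+ + a ℤ.* (D ℤ.- Dδ (suc j)))
      ∎)
    where
    open ≡-Reasoning
    open +-*-Solver
    distribute : ∀ d A d′ E → (d + A * (1ℚ - d′)) * E ≡ d * E + A * (E - d′ * E)
    distribute = solve 4
      (λ d A d′ E → (d :+ A :* (con 1ℚ :- d′)) :* E := d :* E :+ A :* (E :- d′ :* E)) refl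

  Dδ-increases : 1 ℕ.≤ a → ∀ j → output a q (suc (suc j)) ≡ ℕ→ℚ a → Dδ j ℤ.< Dδ (suc (suc j))
  Dδ-increases a≥1 j out≡a = subst (Dδ j ℤ.<_) (sym (Dδ-rec j out≡a))
    (i<i+m*n (Dδ j) (ℤ.+<+ a≥1) (i<j⇒0<j-i (Dδ<D (suc j))))

open import Data.Nat using (_≤_; _+_)
open import Data.Rational using (_<_; -_; 1ℚ)

mainTheorem11 : (a : ℕ) → 1 ≤ a → (q : ℚ) → (- 1ℚ) < q → q < 1ℚ →
    ∃ λ (C : ℕ) → ∀ (i : ℕ) → ¬ (∀ (k : ℕ) → k ≤ C → output a q (i + k) ≡ ℕ→ℚ a)
mainTheorem11 a a≥1 q _ _ =
  2 ℕ.* ↧ₙ q , no-long-run Dδ (↧ₙ q) (λ k → output a q k ≡ ℕ→ℚ a) 0≤Dδ Dδ<D (Dδ-increases a≥1)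
  where open Algorithm a q
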